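{- Consider an instance of the Bin Packing with Usage Cost problem: $n$ items with positive integer sizes $w_1\le\dots\le w_n$, total size $W=\sum_{i=1}^n w_i$, and $m$ bins where bin $j$ has positive integer capacity $C_j$, non-negative fixed cost $f_j$ and non-negative unit cost $c_j$. Assume $\sum_{j=1}^m C_j\ge W$. Let $r_j=f_j/C_j+c_j$ and let $a_1,\dots,a_m$ be a permutation of $\{1,\dots,m\}$ with $r_{a_1}\le r_{a_2}\le\dots\le r_{a_m}$. Let $k$ be the minimum number such that $\sum_{j=1}^k C_{a_j}\ge W$, and define $$Lb_1=\sum_{j=1}^{k-1} C_{a_j}r_{a_j}+\Big(W-\sum_{j=1}^{k-1}C_{a_j}\Big)r_{a_k}.$$ Let $z_1^*$ be the optimal value of the linear programming relaxation (obtained by replacing $x_{ij}\in\{0,1\}$, $y_j\in\{0,1\}$ with $0\le x_{ij}\le 1$, $0\le y_j\le 1$) of the integer program $$\min z_1=\sum_{j=1}^m (f_jy_j+c_jl_j)$$ subject to $\sum_{j=1}^m x_{ij}=1$ for all $i\in\{1,\dots,n\}$; $\sum_{i=1}^n w_ix_{ij}=l_j$ for all $j\in\{1,\dots,m\}$; $l_j\le C_jy_j$ for all $j$; $x_{ij}\in\{0,1\}$, $y_j\in\{0,1\}$, $l_j\ge 0$. Then $z_1^*\ge Lb_1$.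
   Context: In the Bin Packing with Usage Cost problem, each item must be assigned to exactly one bin without exceeding bin capacities; a bin is used if it contains at least one item, and a used bin $j$ with load $l_j$ (total size of its items) costs $f_j+c_jl_j$; the objective is to minimise total cost. In the integer program, $x_{ij}=1$ iff item $i$ is in bin $j$, $y_j=1$ iff bin $j$ is used, and $l_j$ is the load of bin $j$.
   Formalization: The costs $f_j$ and $c_j$ and the variables $x_{ij}$, $y_j$, $l_j$ of the linear programming relaxation take rational values. -}

module Defs where

open import Data.Nat as ℕ using (ℕ; zero; suc)
open import Data.Fin using (Fin; zero; suc; toℕ)
open import Data.Integer using (+_)
open import Data.Rational using (ℚ; 0ℚ; _+_; _*_; _-_; _/_)

ℕ→ℚ : ℕ → ℚ
ℕ→ℚ n = + n / 1

ΣF : ∀ {n} → (Fin n → ℚ) → ℚ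
ΣF {zero} f = 0ℚ
ΣF {suc n} f = f zero + ΣF (λ i → f (suc i))

-- prefix sum: Σ_{i < k} f i  (0-based indices, i.e. the first k terms)
psum : ∀ {m} → (Fin m → ℚ) → ℕ → ℚ
psum {zero} f k = 0ℚ
psum {suc m} f zero = 0ℚ
psum {suc m} f (suc k) = f zero + psum (λ i → f (suc i)) k

-- p / C for a natural number C (only used with C > 0; the C = 0 branch is a dummy)
divℕ : ℚ → ℕ → ℚ
divℕ p zero = 0ℚ
divℕ p (suc c) = p * (+ 1 / suc c)

totalSize : ∀ {n} → (Fin n → ℕ) → ℚ
totalSize w = ΣF (λ i → ℕ→ℚ (w i))

ratio : ∀ {m} → (Fin m → ℕ) → (Fin m → ℚ) → (Fin m → ℚ) → Fin m → ℚ
ratio C f c j = divℕ (f j) (C j) + c j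

module Submission where

-- For a feasible LP solution (x, y, l):
--   1. Per bin, rⱼ·lⱼ ≤ fⱼ·yⱼ + cⱼ·lⱼ, because lⱼ ≤ Cⱼ·yⱼ and fⱼ ≥ 0
--      (lemma per-bin-cost).  Hence Σⱼ rⱼ·lⱼ ≤ z₁.
--   2. The loads carry exactly the total size: Σⱼ lⱼ = W, by exchanging
--      the double sum Σⱼ Σᵢ wᵢ·xᵢⱼ and using Σⱼ xᵢⱼ = 1 (lemma total-load).
--   3. For any loads 0 ≤ L_p ≤ Cap_p and rates sorted around a threshold
--      index k (r_p ≤ R before k, R ≤ r_p from k on, with R = r_k), the
--      greedy filling of the first k bins is cheapest:
--        Σ_{p<k} Cap_p·r_p + (Σ_p L_p − Σ_{p<k} Cap_p)·R ≤ Σ_p r_p·L_p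
--      (lemma fractional-greedy-bound).
-- Applying 3 to the loads listed in the sorted order a (ΣF-permute keeps
-- their sum) and chaining with 2 and 1 gives Lb₁ ≤ z₁.

open import Defs
open import Data.Nat as ℕ using (ℕ; zero; suc)
import Data.Nat.Properties as ℕ
open import Data.Nat.Coprimality using (1-coprimeTo) renaming (sym to coprime-sym)
open import Data.Fin as Fin using (Fin; toℕ)
open import Data.Fin.Permutation using (Permutation′; _⟨$⟩ʳ_)
open import Data.Integer as ℤ using ()
open import Data.Rational using (ℚ; 0ℚ; 1ℚ; _+_; _*_; _-_; _≤_; _<_; mkℚ; -_; _/_; nonNegative)
open import Data.Rational.Properties
open import Data.Rational.Solver using (module +-*-Solver)
open import Algebra.Bundles using (CommutativeRing)
import Algebra.Properties.Semiring.Sum as SemiringSum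
open import Relation.Binary.PropositionalEquality

open +-*-Solver

*-monoˡ-nonNeg : ∀ {a b d} → 0ℚ ≤ a → b ≤ d → a * b ≤ a * d
*-monoˡ-nonNeg {a} 0≤a = *-monoˡ-≤-nonNeg a {{nonNegative 0≤a}}

*-nonNeg : ∀ {a b} → 0ℚ ≤ a → 0ℚ ≤ b → 0ℚ ≤ a * b
*-nonNeg {a} {b} 0≤a 0≤b = subst (_≤ a * b) (*-zeroʳ a) (*-monoˡ-nonNeg 0≤a 0≤b)

≤-+-nonNeg : ∀ a {b} → 0ℚ ≤ b → a ≤ a + b
≤-+-nonNeg a {b} 0≤b = subst (_≤ a + b) (+-identityʳ a) (+-monoʳ-≤ a 0≤b)

≤⇒0≤- : ∀ {p q} → q ≤ p → 0ℚ ≤ p - q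
≤⇒0≤- {p} {q} q≤p = subst (_≤ p - q) (+-inverseʳ q) (+-monoˡ-≤ (- q) q≤p)

0≤ℕ→ℚ : ∀ n → 0ℚ ≤ ℕ→ℚ n
0≤ℕ→ℚ n = nonNegative⁻¹ (ℕ→ℚ n) {{normalize-nonNeg n 1}}

-- The normal forms of 1 + c and 1/(1 + c); normalisation of the literals
-- ℕ→ℚ (suc c) and + 1 / suc c does not compute for a variable c, so we
-- pass through these canonical representatives.
private
  succℚ : ℕ → ℚ
  succℚ c = mkℚ (ℤ.+ suc c) 0 (coprime-sym (1-coprimeTo (suc c)))

  invSuccℚ : ℕ → ℚ
  invSuccℚ c = mkℚ (ℤ.+ 1) c (1-coprimeTo (suc c))

divℕ-*-cancel : ∀ p c → divℕ p (suc c) * ℕ→ℚ (suc c) ≡ p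
divℕ-*-cancel p c = begin
  p * (ℤ.+ 1 / suc c) * ℕ→ℚ (suc c) ≡⟨ cong₂ (λ s t → p * s * t) (↥p/↧p≡p (invSuccℚ c)) (↥p/↧p≡p (succℚ c)) ⟩
  p * invSuccℚ c * succℚ c          ≡⟨ *-assoc p (invSuccℚ c) (succℚ c) ⟩
  p * (invSuccℚ c * succℚ c)        ≡⟨ cong (p *_) (*-inverseˡ (succℚ c)) ⟩
  p * 1ℚ                            ≡⟨ *-identityʳ p ⟩
  p                                 ∎
  where open ≡-Reasoning

divℕ-nonNeg : ∀ {p} C → 0ℚ ≤ p → 0ℚ ≤ divℕ p C
divℕ-nonNeg zero    _   = ≤-refl
divℕ-nonNeg (suc c) 0≤p = *-nonNeg 0≤p (nonNegative⁻¹ _ {{normalize-nonNeg 1 (suc c)}})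

module Σℚ = SemiringSum (CommutativeRing.semiring +-*-commutativeRing)

ΣF≡sum : ∀ {n} (g : Fin n → ℚ) → ΣF g ≡ Σℚ.sum g
ΣF≡sum {zero}  g = refl
ΣF≡sum {suc n} g = cong (g Fin.zero +_) (ΣF≡sum (λ i → g (Fin.suc i)))

ΣF-cong : ∀ {n} {g h : Fin n → ℚ} → (∀ i → g i ≡ h i) → ΣF g ≡ ΣF h
ΣF-cong {g = g} {h} g≗h = trans (ΣF≡sum g) (trans (Σℚ.sum-cong-≗ g≗h) (sym (ΣF≡sum h)))

ΣF-mono : ∀ {n} {g h : Fin n → ℚ} → (∀ i → g i ≤ h i) → ΣF g ≤ ΣF h
ΣF-mono {zero}  g≤h = ≤-refl
ΣF-mono {suc n} g≤h = +-mono-≤ (g≤h Fin.zero) (ΣF-mono (λ i → g≤h (Fin.suc i)))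

ΣF-+ : ∀ {n} (g h : Fin n → ℚ) → ΣF (λ i → g i + h i) ≡ ΣF g + ΣF h
ΣF-+ {zero}  g h = sym (+-identityʳ 0ℚ)
ΣF-+ {suc n} g h = begin
  (g₀ + h₀) + ΣF (λ i → g⁺ i + h⁺ i) ≡⟨ cong ((g₀ + h₀) +_) (ΣF-+ g⁺ h⁺) ⟩
  (g₀ + h₀) + (ΣF g⁺ + ΣF h⁺)         ≡⟨ solve 4 (λ a b c d → (a :+ b) :+ (c :+ d) := (a :+ c) :+ (b :+ d))
                                                refl g₀ h₀ (ΣF g⁺) (ΣF h⁺) ⟩
  (g₀ + ΣF g⁺) + (h₀ + ΣF h⁺)         ∎
  where
  open ≡-Reasoning
  g₀ = g Fin.zero
  h₀ = h Fin.zero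
  g⁺ = λ i → g (Fin.suc i)
  h⁺ = λ i → h (Fin.suc i)

ΣF-zero : ∀ n → ΣF {n} (λ _ → 0ℚ) ≡ 0ℚ
ΣF-zero zero    = refl
ΣF-zero (suc n) = trans (+-identityˡ _) (ΣF-zero n)

ΣF-*ˡ : ∀ {n} (a : ℚ) (g : Fin n → ℚ) → a * ΣF g ≡ ΣF (λ i → a * g i)
ΣF-*ˡ a g = trans (cong (a *_) (ΣF≡sum g)) (trans (Σℚ.*-distribˡ-sum a g) (sym (ΣF≡sum (λ i → a * g i))))

ΣF-swap : ∀ {n m} (g : Fin n → Fin m → ℚ) →
          ΣF (λ i → ΣF (λ j → g i j)) ≡ ΣF (λ j → ΣF (λ i → g i j))
ΣF-swap {zero}  {m} g = sym (ΣF-zero m)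
ΣF-swap {suc n} {m} g =
  trans (cong (ΣF (g Fin.zero) +_) (ΣF-swap (λ i → g (Fin.suc i))))
        (sym (ΣF-+ (g Fin.zero) (λ j → ΣF (λ i → g (Fin.suc i) j))))

ΣF-permute : ∀ {m} (g : Fin m → ℚ) (a : Permutation′ m) → ΣF g ≡ ΣF (λ p → g (a ⟨$⟩ʳ p))
ΣF-permute g a = trans (ΣF≡sum g) (trans (Σℚ.sum-permute g a) (sym (ΣF≡sum (λ p → g (a ⟨$⟩ʳ p)))))

per-bin-cost : ∀ (C : ℕ) (f c l y : ℚ) → 0 ℕ.< C → 0ℚ ≤ f → l ≤ ℕ→ℚ C * y →
               (divℕ f C + c) * l ≤ f * y + c * l
per-bin-cost (suc k) f c l y _ 0≤f l≤Cy = begin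
  (f/C + c) * l         ≡⟨ *-distribʳ-+ l f/C c ⟩
  f/C * l + c * l       ≤⟨ +-monoˡ-≤ (c * l) (*-monoˡ-nonNeg (divℕ-nonNeg (suc k) 0≤f) l≤Cy) ⟩
  f/C * (C * y) + c * l ≡⟨ cong (_+ c * l) (sym (*-assoc f/C C y)) ⟩
  f/C * C * y + c * l   ≡⟨ cong (λ z → z * y + c * l) (divℕ-*-cancel f k) ⟩
  f * y + c * l         ∎
  where
  open ≤-Reasoning
  f/C C : ℚ
  f/C = divℕ f (suc k)
  C   = ℕ→ℚ (suc k)

total-load : ∀ {n m} (w : Fin n → ℕ) (x : Fin n → Fin m → ℚ) (l : Fin m → ℚ) →
             (∀ i → ΣF (x i) ≡ 1ℚ) →
             (∀ j → ΣF (λ i → ℕ→ℚ (w i) * x i j) ≡ l j) →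
             ΣF l ≡ totalSize w
total-load w x l assigned load = begin
  ΣF l                                      ≡⟨ ΣF-cong (λ j → sym (load j)) ⟩
  ΣF (λ j → ΣF (λ i → ℕ→ℚ (w i) * x i j)) ≡⟨ sym (ΣF-swap (λ i j → ℕ→ℚ (w i) * x i j)) ⟩
  ΣF (λ i → ΣF (λ j → ℕ→ℚ (w i) * x i j)) ≡⟨ ΣF-cong (λ i → sym (ΣF-*ˡ (ℕ→ℚ (w i)) (x i))) ⟩
  ΣF (λ i → ℕ→ℚ (w i) * ΣF (x i))          ≡⟨ ΣF-cong (λ i → trans (cong (ℕ→ℚ (w i) *_) (assigned i))
                                                                    (*-identityʳ _)) ⟩
  totalSize w                               ∎
  where open ≡-Reasoning

rate-lower-bound : ∀ {m} (r L : Fin m → ℚ) (R : ℚ) →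
                   (∀ p → 0ℚ ≤ L p) → (∀ p → R ≤ r p) →
                   ΣF L * R ≤ ΣF (λ p → r p * L p)
rate-lower-bound r L R 0≤L R≤r = begin
  ΣF L * R              ≡⟨ *-comm (ΣF L) R ⟩
  R * ΣF L              ≡⟨ ΣF-*ˡ R L ⟩
  ΣF (λ p → R * L p)    ≤⟨ ΣF-mono (λ p → *-monoʳ-≤-nonNeg (L p) {{nonNegative (0≤L p)}} (R≤r p)) ⟩
  ΣF (λ p → r p * L p)  ∎
  where open ≤-Reasoning

-- A bin of rate r ≤ R filled to capacity, with the difference between its
-- actual load L and its capacity charged at rate R, costs at most r·L:
-- the gap is (R − r)(Cap − L) ≥ 0.
cheap-bin-exchange : ∀ {r R L Cap} → r ≤ R → L ≤ Cap → Cap * r + (L - Cap) * R ≤ r * L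
cheap-bin-exchange {r} {R} {L} {Cap} r≤R L≤Cap = begin
  Cap * r + (L - Cap) * R                         ≤⟨ ≤-+-nonNeg _ (*-nonNeg (≤⇒0≤- r≤R) (≤⇒0≤- L≤Cap)) ⟩
  Cap * r + (L - Cap) * R + (R - r) * (Cap - L)   ≡⟨ solve 4 (λ Cap r L R →
                                                        Cap :* r :+ (L :- Cap) :* R :+ (R :- r) :* (Cap :- L)
                                                        := r :* L) refl Cap r L R ⟩
  r * L                                           ∎
  where open ≤-Reasoning

fractional-greedy-bound :
  ∀ {m} (r Cap L : Fin m → ℚ) (R : ℚ) (k : ℕ) →
  (∀ p → 0ℚ ≤ L p) → (∀ p → L p ≤ Cap p) →
  (∀ p → toℕ p ℕ.< k → r p ≤ R) → (∀ p → k ℕ.≤ toℕ p → R ≤ r p) →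
  psum (λ p → Cap p * r p) k + (ΣF L - psum Cap k) * R ≤ ΣF (λ p → r p * L p)
fractional-greedy-bound {zero} r Cap L R k _ _ _ _ =
  ≤-reflexive (solve 1 (λ R → con 0ℚ :+ (con 0ℚ :- con 0ℚ) :* R := con 0ℚ) refl R)
fractional-greedy-bound {suc m} r Cap L R zero 0≤L _ _ R≤r = begin
  0ℚ + (ΣF L - 0ℚ) * R ≡⟨ solve 2 (λ S R → con 0ℚ :+ (S :- con 0ℚ) :* R := S :* R) refl (ΣF L) R ⟩
  ΣF L * R             ≤⟨ rate-lower-bound r L R 0≤L (λ p → R≤r p ℕ.z≤n) ⟩
  ΣF (λ p → r p * L p) ∎
  where open ≤-Reasoning
fractional-greedy-bound {suc m} r Cap L R (suc k) 0≤L L≤Cap below above = begin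
  (Cap₀ * r₀ + P) + ((L₀ + S) - (Cap₀ + Q)) * R
    ≡⟨ solve 7 (λ Cap₀ r₀ P L₀ S Q R → (Cap₀ :* r₀ :+ P) :+ ((L₀ :+ S) :- (Cap₀ :+ Q)) :* R
                 := (Cap₀ :* r₀ :+ (L₀ :- Cap₀) :* R) :+ (P :+ (S :- Q) :* R)) refl Cap₀ r₀ P L₀ S Q R ⟩
  (Cap₀ * r₀ + (L₀ - Cap₀) * R) + (P + (S - Q) * R)
    ≤⟨ +-mono-≤ (cheap-bin-exchange (below Fin.zero (ℕ.s≤s ℕ.z≤n)) (L≤Cap Fin.zero)) rest ⟩
  r₀ * L₀ + ΣF (λ p → r (Fin.suc p) * L (Fin.suc p)) ∎
  where
  open ≤-Reasoning
  r₀ Cap₀ L₀ S P Q : ℚ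
  r₀   = r Fin.zero
  Cap₀ = Cap Fin.zero
  L₀   = L Fin.zero
  S    = ΣF (λ p → L (Fin.suc p))
  P    = psum (λ p → Cap (Fin.suc p) * r (Fin.suc p)) k
  Q    = psum (λ p → Cap (Fin.suc p)) k
  rest : P + (S - Q) * R ≤ ΣF (λ p → r (Fin.suc p) * L (Fin.suc p))
  rest = fractional-greedy-bound (λ p → r (Fin.suc p)) (λ p → Cap (Fin.suc p)) (λ p → L (Fin.suc p)) R k
           (λ p → 0≤L (Fin.suc p)) (λ p → L≤Cap (Fin.suc p))
           (λ p p<k → below (Fin.suc p) (ℕ.s≤s p<k)) (λ p k≤p → above (Fin.suc p) (ℕ.s≤s k≤p))

proposition1 : (n m : ℕ) (w : Fin n → ℕ) (C : Fin m → ℕ) (f c : Fin m → ℚ) →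
    (∀ i → 0 ℕ.< w i) →
    (∀ i i′ → i Fin.≤ i′ → w i ℕ.≤ w i′) →
    (∀ j → 0 ℕ.< C j) →
    (∀ j → 0ℚ ≤ f j) →
    (∀ j → 0ℚ ≤ c j) →
    totalSize w ≤ ΣF (λ j → ℕ→ℚ (C j)) →
    (a : Permutation′ m) →
    (∀ j j′ → j Fin.≤ j′ → ratio C f c (a ⟨$⟩ʳ j) ≤ ratio C f c (a ⟨$⟩ʳ j′)) →
    (kk : Fin m) →
    totalSize w ≤ psum (λ j → ℕ→ℚ (C (a ⟨$⟩ʳ j))) (ℕ.suc (toℕ kk)) →
    psum (λ j → ℕ→ℚ (C (a ⟨$⟩ʳ j))) (toℕ kk) < totalSize w →
    (x : Fin n → Fin m → ℚ) (y : Fin m → ℚ) (l : Fin m → ℚ) →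
    (∀ i j → 0ℚ ≤ x i j) → (∀ i j → x i j ≤ 1ℚ) →
    (∀ j → 0ℚ ≤ y j) → (∀ j → y j ≤ 1ℚ) →
    (∀ j → 0ℚ ≤ l j) →
    (∀ i → ΣF (λ j → x i j) ≡ 1ℚ) →
    (∀ j → ΣF (λ i → ℕ→ℚ (w i) * x i j) ≡ l j) →
    (∀ j → l j ≤ ℕ→ℚ (C j) * y j) →
    psum (λ j → ℕ→ℚ (C (a ⟨$⟩ʳ j)) * ratio C f c (a ⟨$⟩ʳ j)) (toℕ kk)
    + (totalSize w - psum (λ j → ℕ→ℚ (C (a ⟨$⟩ʳ j))) (toℕ kk)) * ratio C f c (a ⟨$⟩ʳ kk)
    ≤ ΣF (λ j → f j * y j + c j * l j)
proposition1 n m w C f c _ _ 0<C 0≤f _ _ a sorted kk _ _ x y l _ _ _ y≤1 0≤l assigned load l≤Cy =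
  begin
    psum (λ p → Cap p * r p) k + (totalSize w - psum Cap k) * R
      ≡⟨ cong (λ W → psum (λ p → Cap p * r p) k + (W - psum Cap k) * R) (sym sorted-load) ⟩
    psum (λ p → Cap p * r p) k + (ΣF L - psum Cap k) * R
      ≤⟨ fractional-greedy-bound r Cap L R k (λ p → 0≤l (a ⟨$⟩ʳ p)) (λ p → l≤C (a ⟨$⟩ʳ p))
           (λ p p<k → sorted p kk (ℕ.<⇒≤ p<k)) (λ p k≤p → sorted kk p k≤p) ⟩
    ΣF (λ p → r p * L p)
      ≡⟨ sym (ΣF-permute (λ j → ratio C f c j * l j) a) ⟩
    ΣF (λ j → ratio C f c j * l j)
      ≤⟨ ΣF-mono (λ j → per-bin-cost (C j) (f j) (c j) (l j) (y j) (0<C j) (0≤f j) (l≤Cy j)) ⟩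
    ΣF (λ j → f j * y j + c j * l j) ∎
  where
  open ≤-Reasoning
  k : ℕ
  k   = toℕ kk
  r Cap L : Fin m → ℚ
  r   = λ p → ratio C f c (a ⟨$⟩ʳ p)
  Cap = λ p → ℕ→ℚ (C (a ⟨$⟩ʳ p))
  L   = λ p → l (a ⟨$⟩ʳ p)
  R : ℚ
  R   = ratio C f c (a ⟨$⟩ʳ kk)
  l≤C : ∀ j → l j ≤ ℕ→ℚ (C j)
  l≤C j = ≤-trans (l≤Cy j) (subst (ℕ→ℚ (C j) * y j ≤_) (*-identityʳ _) (*-monoˡ-nonNeg (0≤ℕ→ℚ (C j)) (y≤1 j)))
  sorted-load : ΣF L ≡ totalSize w
  sorted-load = trans (sym (ΣF-permute l a)) (total-load w x l assigned load)
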